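{- Let $(f_i)_{i\ge 0}$ be the Fibonacci numbers with $f_0=f_1=1$ and $f_{i+2}=f_i+f_{i+1}$. Let $(m_i)_{i\ge 0}$ be defined by $(m_0,m_1,m_2)=(0,1,3)$ and $m_{i+3}=2(m_{i+1}+m_{i+2})+1-m_i$ for $i\ge 0$. Then for every $k\ge 0$, $m_k=f_k^2$ if $k$ is odd and $m_k=f_k^2-1$ if $k$ is even. -}

module Defs where

open import Data.Nat using (ℕ; zero; suc)
open import Data.Integer using (ℤ; +_; _+_; _-_; _*_)

fib : ℕ → ℤ
fib zero = + 1
fib (suc zero) = + 1
fib (suc (suc i)) = fib i + fib (suc i)

m : ℕ → ℤ
m zero = + 0
m (suc zero) = + 1
m (suc (suc zero)) = + 3
m (suc (suc (suc i))) = (+ 2 * (m (suc i) + m (suc (suc i))) + + 1) - m i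

open import Data.Nat.Divisibility using (_∣_)
open import Relation.Nullary using (¬_)

Even : ℕ → Set
Even k = 2 ∣ k

Odd : ℕ → Set
Odd k = ¬ (2 ∣ k)

-- With e k = 1 for even k and 0 for odd k, the claim is m k = f k ² − e k.
-- Squares of a Fibonacci-type sequence a, b, a + b, a + 2b satisfy
-- (a + 2b)² = 2 (b² + (a + b)²) − a², which is the recurrence of m without
-- its "+ 1"; that constant is absorbed by the corrections, since e i + e (i + 1) = 1.
module Submission where

open import Defs
open import Data.Nat using (ℕ; zero; suc)
open import Data.Integer using (ℤ; +_; _+_; _-_; _*_)
open import Data.Integer.Properties using (+-identityʳ)
open import Data.Integer.Tactic.RingSolver using (solve-∀)
open import Data.Nat.Divisibility using (divides; ∣-refl; ∣1⇒≡1; ∣m∣n⇒∣m+n; ∣m+n∣m⇒∣n)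
open import Data.Empty using (⊥-elim)
open import Data.Product using (_×_; _,_)
open import Relation.Binary.PropositionalEquality
  using (_≡_; refl; cong; sym; module ≡-Reasoning)

evenIndicator : ℕ → ℤ
evenIndicator zero = + 1
evenIndicator (suc zero) = + 0
evenIndicator (suc (suc k)) = evenIndicator k

evenIndicator+evenIndicator-suc : ∀ k → evenIndicator k + evenIndicator (suc k) ≡ + 1
evenIndicator+evenIndicator-suc zero = refl
evenIndicator+evenIndicator-suc (suc zero) = refl
evenIndicator+evenIndicator-suc (suc (suc k)) = evenIndicator+evenIndicator-suc k

evenIndicator-even : ∀ k → Even k → evenIndicator k ≡ + 1
evenIndicator-even zero _ = refl
evenIndicator-even (suc zero) 2∣1 with () ← ∣1⇒≡1 2∣1
evenIndicator-even (suc (suc k)) 2∣2+k = evenIndicator-even k (∣m+n∣m⇒∣n {m = 2} 2∣2+k ∣-refl)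

evenIndicator-odd : ∀ k → Odd k → evenIndicator k ≡ + 0
evenIndicator-odd zero 2∤0 = ⊥-elim (2∤0 (divides 0 refl))
evenIndicator-odd (suc zero) _ = refl
evenIndicator-odd (suc (suc k)) 2∤2+k = evenIndicator-odd k (λ 2∣k → 2∤2+k (∣m∣n⇒∣m+n ∣-refl 2∣k))

square-recurrence : ∀ a b → (b + (a + b)) * (b + (a + b)) ≡ + 2 * (b * b + (a + b) * (a + b)) - a * a
square-recurrence = solve-∀

corrected-square-recurrence : ∀ a b x y → x + y ≡ + 1 →
  + 2 * ((b * b - y) + ((a + b) * (a + b) - x)) + + 1 - (a * a - x)
    ≡ (b + (a + b)) * (b + (a + b)) - y
corrected-square-recurrence a b x y x+y≡1 = begin
  + 2 * ((b * b - y) + ((a + b) * (a + b) - x)) + + 1 - (a * a - x)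
    ≡⟨ cong (λ one → + 2 * ((b * b - y) + ((a + b) * (a + b) - x)) + one - (a * a - x)) (sym x+y≡1) ⟩
  + 2 * ((b * b - y) + ((a + b) * (a + b) - x)) + (x + y) - (a * a - x)
    ≡⟨ regroup a b x y ⟩
  (+ 2 * (b * b + (a + b) * (a + b)) - a * a) - y
    ≡⟨ cong (_- y) (sym (square-recurrence a b)) ⟩
  (b + (a + b)) * (b + (a + b)) - y ∎
  where
  open ≡-Reasoning
  regroup : ∀ a b x y → + 2 * ((b * b - y) + ((a + b) * (a + b) - x)) + (x + y) - (a * a - x)
                     ≡ (+ 2 * (b * b + (a + b) * (a + b)) - a * a) - y
  regroup = solve-∀

m≡fib²-evenIndicator : ∀ k → m k ≡ fib k * fib k - evenIndicator k
m≡fib²-evenIndicator zero = refl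
m≡fib²-evenIndicator (suc zero) = refl
m≡fib²-evenIndicator (suc (suc zero)) = refl
m≡fib²-evenIndicator (suc (suc (suc i))) =
  recurrence-step (m≡fib²-evenIndicator i) (m≡fib²-evenIndicator (suc i)) (m≡fib²-evenIndicator (suc (suc i)))
  where
  a = fib i
  b = fib (suc i)
  x = evenIndicator i
  y = evenIndicator (suc i)
  recurrence-step : ∀ {u v w} → u ≡ a * a - x → v ≡ b * b - y → w ≡ (a + b) * (a + b) - x →
                    + 2 * (v + w) + + 1 - u ≡ (b + (a + b)) * (b + (a + b)) - y
  recurrence-step refl refl refl = corrected-square-recurrence a b x y (evenIndicator+evenIndicator-suc i)

proposition7p3 : (k : ℕ) → (Odd k → m k ≡ fib k * fib k) × (Even k → m k ≡ fib k * fib k - + 1)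
proposition7p3 k = odd-case , even-case
  where
  open ≡-Reasoning
  odd-case : Odd k → m k ≡ fib k * fib k
  odd-case 2∤k = begin
    m k                              ≡⟨ m≡fib²-evenIndicator k ⟩
    fib k * fib k - evenIndicator k  ≡⟨ cong (fib k * fib k -_) (evenIndicator-odd k 2∤k) ⟩
    fib k * fib k - + 0              ≡⟨ +-identityʳ (fib k * fib k) ⟩
    fib k * fib k                    ∎
  even-case : Even k → m k ≡ fib k * fib k - + 1
  even-case 2∣k = begin
    m k                              ≡⟨ m≡fib²-evenIndicator k ⟩
    fib k * fib k - evenIndicator k  ≡⟨ cong (fib k * fib k -_) (evenIndicator-even k 2∣k) ⟩
    fib k * fib k - + 1              ∎
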